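{- Let $H=(V,E)$ be a hypergraph. Then $\kappa_S(H)\leq \kappa_W(H)$.
   Context: A hypergraph $H=(V,E)$ consists of a finite vertex set $V$ and a finite multiset $E$ of edges, each a submultiset of $V$. $H$ is null if $V=\emptyset$, trivial if $|V|=1$, nontrivial otherwise. A path is a sequence $v_1,e_1,v_2,\dots,e_s,v_{s+1}$ of distinct vertices and distinct edges with the multiset $[v_j,v_{j+1}]\subseteq e_j$ for each $j$; $H$ is connected if every two vertices are joined by a path, disconnected otherwise. For $X\subseteq V$: the strong deletion $H\setminus_S X$ removes $X$ and every edge containing a vertex of $X$; the weak deletion $H\setminus_W X$ removes $X$ from $V$ and every occurrence of vertices of $X$ from every edge, keeping all edges. For $\ast\in\{S,W\}$: $\kappa_\ast(H)=1$ if $H$ is null or trivial; for nontrivial $H$, $\kappa_\ast(H)$ is the minimum $|X|$ over $X\subseteq V$ with $H\setminus_\ast X$ disconnected if such $X$ exists, and $|V|-1$ otherwise. -}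

module Defs where

open import Data.Nat using (ℕ; zero; suc; _≤_; _<_; _∸_; _+_)
open import Data.Bool using (Bool; true; false; _∧_; not; if_then_else_)
open import Data.Fin using (Fin; zero; suc; inject₁; fromℕ; _≟_)
open import Data.Fin.Subset using (Subset; _∈_; _∉_; _⊆_; _─_; ∣_∣)
open import Data.Vec using (lookup)
open import Data.List using (List; []; _∷_; length; allFin)
open import Data.Bool.ListAction using (any)
import Data.List as L
open import Data.Product using (Σ; ∃; _×_; _,_)
open import Data.Sum using (_⊎_)
open import Function.Definitions using (Injective)
open import Relation.Binary.PropositionalEquality using (_≡_; _≢_)
open import Relation.Nullary using (¬_; does)

Multiset : ℕ → Set
Multiset n = Fin n → ℕ

_⊆ₘ_ : ∀ {n} → Multiset n → Multiset n → Set
A ⊆ₘ B = ∀ v → A v ≤ B v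

pairMS : ∀ {n} → Fin n → Fin n → Multiset n
pairMS a b v = (if does (v ≟ a) then 1 else 0) + (if does (v ≟ b) then 1 else 0)

-- A hypergraph whose vertex set V is a finite subset of the ambient universe
-- Fin n, and whose edges form a finite multiset (a list) of multisets.
record Hypergraph (n : ℕ) : Set where
  constructor hg
  field
    V : Subset n
    E : List (Multiset n)
open Hypergraph public

WellFormed : ∀ {n} → Hypergraph n → Set
WellFormed H = ∀ (i : Fin (length (E H))) v → 0 < L.lookup (E H) i v → v ∈ V H

-- Paths: v_1, e_1, v_2, ..., e_s, v_{s+1}, distinct vertices (in V) and
-- distinct edges (distinct positions in the edge multiset), [v_j,v_{j+1}] ⊆ e_j.
record Path {n} (H : Hypergraph n) (u w : Fin n) : Set where
  field
    s      : ℕ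
    vs     : Fin (suc s) → Fin n
    es     : Fin s → Fin (length (E H))
    vs-inj : Injective _≡_ _≡_ vs
    es-inj : Injective _≡_ _≡_ es
    vs-in  : ∀ j → vs j ∈ V H
    start  : vs zero ≡ u
    end    : vs (fromℕ s) ≡ w
    step   : ∀ j → pairMS (vs (inject₁ j)) (vs (suc j)) ⊆ₘ L.lookup (E H) (es j)

Connected : ∀ {n} → Hypergraph n → Set
Connected H = ∀ u w → u ∈ V H → w ∈ V H → Path H u w

Disconnected : ∀ {n} → Hypergraph n → Set
Disconnected H = ¬ Connected H

meets : ∀ {n} → Subset n → Multiset n → Bool
meets {n} X e = any (λ v → lookup X v ∧ not (does (e v Data.Nat.≟ 0))) (allFin n)
  where import Data.Nat

filterB : ∀ {A : Set} → (A → Bool) → List A → List A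
filterB p [] = []
filterB p (x ∷ xs) = if p x then x ∷ filterB p xs else filterB p xs

strongDel : ∀ {n} → Hypergraph n → Subset n → Hypergraph n
strongDel H X = hg (V H ─ X) (filterB (λ e → not (meets X e)) (E H))

weakDel : ∀ {n} → Hypergraph n → Subset n → Hypergraph n
weakDel H X = hg (V H ─ X) (L.map (λ e v → if lookup X v then 0 else e v) (E H))

IsKappa : ∀ {n} → (Hypergraph n → Subset n → Hypergraph n) → Hypergraph n → ℕ → Set
IsKappa {n} del H k =
    (∣ V H ∣ ≤ 1 × k ≡ 1)
  ⊎ (2 ≤ ∣ V H ∣ ×
      ( (Σ (Subset n) λ X → X ⊆ V H × Disconnected (del H X) × ∣ X ∣ ≡ k
           × (∀ Y → Y ⊆ V H → Disconnected (del H Y) → k ≤ ∣ Y ∣))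
      ⊎ ((∀ X → X ⊆ V H → ¬ Disconnected (del H X)) × k ≡ ∣ V H ∣ ∸ 1)))

κS-is : ∀ {n} → Hypergraph n → ℕ → Set
κS-is = IsKappa strongDel

κW-is : ∀ {n} → Hypergraph n → ℕ → Set
κW-is = IsKappa weakDel

-- Strong deletion keeps fewer edges than weak deletion, and the edges it keeps are
-- exactly those that weak deletion leaves untouched; so every path of H ∖_S X is a path
-- of H ∖_W X, and every set that weakly disconnects H also strongly disconnects it.
-- The only remaining case is κ_W(H) = |V| − 1 with no weakly disconnecting set; then
-- a strongly disconnecting set Y must leave a vertex behind (a hypergraph without
-- vertices is connected), so Y ⊂ V and κ_S(H) ≤ |Y| ≤ |V| − 1.
module Submission where

open import Defs
open import Data.Nat using (ℕ; _≤_; _<_; _∸_; suc; s≤s)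
import Data.Nat as ℕ
open import Data.Nat.Properties using (≤-refl; ≤-trans; ≤-reflexive; <⇒≱)
open import Data.Bool using (Bool; true; false; _∧_; not; if_then_else_; T)
open import Data.Bool.Properties using (not-injective)
open import Data.Fin using (Fin; zero; suc; inject₁)
open import Data.Fin.Properties using (suc-injective)
open import Data.Fin.Subset using (Subset; inside; outside; _∈_; _∉_; _⊆_; _─_; ∣_∣; Nonempty)
open import Data.Fin.Subset.Properties using (nonempty?; p─q⊆p; p⊂q⇒∣p∣<∣q∣)
open import Data.Vec using (_∷_; lookup; here; there)
open import Data.List using (_∷_; length; map)
import Data.List as List
open import Data.List.Membership.Propositional using (lose)
open import Data.List.Membership.Propositional.Properties using (∈-allFin)
open import Data.List.Relation.Unary.Any.Properties using (any⁺)
open import Data.Product using (_,_)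
open import Data.Sum using (inj₁; inj₂)
open import Function using (_∘_)
open import Function.Definitions using (Injective)
open import Relation.Nullary using (yes; no; does; contradiction)
open import Relation.Nullary.Decidable using (dec-false)
open import Relation.Binary.PropositionalEquality using (_≡_; refl; sym; cong; cong₂; subst; module ≡-Reasoning)

x∈p─q⇒x∉q : ∀ {n} {x : Fin n} (p q : Subset n) → x ∈ p ─ q → x ∉ q
x∈p─q⇒x∉q (inside  ∷ p) (inside ∷ q) () here
x∈p─q⇒x∉q (outside ∷ p) (inside ∷ q) () here
x∈p─q⇒x∉q (_ ∷ p) (_ ∷ q) (there x∈p─q) (there x∈q) = x∈p─q⇒x∉q p q x∈p─q x∈q

lookup-filterB : ∀ {A : Set} (p : A → Bool) xs i → p (List.lookup (filterB p xs) i) ≡ true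
lookup-filterB p (x ∷ xs) i with p x in px
lookup-filterB p (x ∷ xs) zero    | true  = px
lookup-filterB p (x ∷ xs) (suc i) | true  = lookup-filterB p xs i
lookup-filterB p (x ∷ xs) i       | false = lookup-filterB p xs i

module _ {A B : Set} (p : A → Bool) (f : A → B) where

  filterB↪map : ∀ xs → Fin (length (filterB p xs)) → Fin (length (map f xs))
  filterB↪map (x ∷ xs) i with p x
  filterB↪map (x ∷ xs) zero    | true  = zero
  filterB↪map (x ∷ xs) (suc i) | true  = suc (filterB↪map xs i)
  filterB↪map (x ∷ xs) i       | false = suc (filterB↪map xs i)

  filterB↪map-injective : ∀ xs → Injective _≡_ _≡_ (filterB↪map xs)
  filterB↪map-injective (x ∷ xs) {i} {j} eq with p x
  filterB↪map-injective (x ∷ xs) {zero}  {zero}  eq | true = refl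
  filterB↪map-injective (x ∷ xs) {suc i} {suc j} eq | true =
    cong suc (filterB↪map-injective xs (suc-injective eq))
  filterB↪map-injective (x ∷ xs) eq | false = filterB↪map-injective xs (suc-injective eq)

  lookup-map-filterB↪map : ∀ xs i →
    List.lookup (map f xs) (filterB↪map xs i) ≡ f (List.lookup (filterB p xs) i)
  lookup-map-filterB↪map (x ∷ xs) i with p x
  lookup-map-filterB↪map (x ∷ xs) zero    | true  = refl
  lookup-map-filterB↪map (x ∷ xs) (suc i) | true  = lookup-map-filterB↪map xs i
  lookup-map-filterB↪map (x ∷ xs) i       | false = lookup-map-filterB↪map xs i

dropOccurrences : ∀ {n} → Subset n → Multiset n → Multiset n
dropOccurrences X e v = if lookup X v then 0 else e v

unmet-edge-vanishes-on : ∀ {n} (X : Subset n) (e : Multiset n) {v} →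
  meets X e ≡ false → lookup X v ≡ true → e v ≡ 0
unmet-edge-vanishes-on {n} X e {v} unmet X[v] with e v ℕ.≟ 0
... | yes ev≡0 = ev≡0
... | no  ev≢0 = contradiction (any⁺ meetsAt (lose (∈-allFin v) meetsAt-v)) (subst T unmet)
  where
  meetsAt : Fin n → Bool
  meetsAt w = lookup X w ∧ not (does (e w ℕ.≟ 0))
  meetsAt-v : T (meetsAt v)
  meetsAt-v = subst T (cong₂ (λ a b → a ∧ not b) (sym X[v]) (sym (dec-false (e v ℕ.≟ 0) ev≢0))) _

dropOccurrences-unmet : ∀ {n} (X : Subset n) (e : Multiset n) →
  meets X e ≡ false → ∀ v → dropOccurrences X e v ≡ e v
dropOccurrences-unmet X e unmet v with lookup X v in X[v]
... | false = refl
... | true  = sym (unmet-edge-vanishes-on X e unmet X[v])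

strongDel-path⇒weakDel-path : ∀ {n} (H : Hypergraph n) (X : Subset n) {u w} →
  Path (strongDel H X) u w → Path (weakDel H X) u w
strongDel-path⇒weakDel-path {n} H X P = record
  { s      = s
  ; vs     = vs
  ; es     = ι ∘ es
  ; vs-inj = vs-inj
  ; es-inj = es-inj ∘ filterB↪map-injective kept (dropOccurrences X) (E H)
  ; vs-in  = vs-in
  ; start  = start
  ; end    = end
  ; step   = step′
  }
  where
  open Path P
  open ≡-Reasoning
  kept : Multiset n → Bool
  kept e = not (meets X e)
  ι : Fin (length (filterB kept (E H))) → Fin (length (map (dropOccurrences X) (E H)))
  ι = filterB↪map kept (dropOccurrences X) (E H)
  kept-edge-unchanged : ∀ i v →
    List.lookup (E (strongDel H X)) i v ≡ List.lookup (E (weakDel H X)) (ι i) v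
  kept-edge-unchanged i v = begin
    e v                                                 ≡⟨ dropOccurrences-unmet X e unmet v ⟨
    dropOccurrences X e v                               ≡⟨ cong (λ e′ → e′ v) lookup-ι ⟨
    List.lookup (map (dropOccurrences X) (E H)) (ι i) v ∎
    where
    e : Multiset n
    e = List.lookup (filterB kept (E H)) i
    unmet : meets X e ≡ false
    unmet = not-injective (lookup-filterB kept (E H) i)
    lookup-ι : List.lookup (map (dropOccurrences X) (E H)) (ι i) ≡ dropOccurrences X e
    lookup-ι = lookup-map-filterB↪map kept (dropOccurrences X) (E H) i
  step′ : ∀ j → pairMS (vs (inject₁ j)) (vs (suc j)) ⊆ₘ List.lookup (E (weakDel H X)) (ι (es j))
  step′ j v = ≤-trans (step j v) (≤-reflexive (kept-edge-unchanged (es j) v))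

weakDel-disconnected⇒strongDel-disconnected : ∀ {n} (H : Hypergraph n) (X : Subset n) →
  Disconnected (weakDel H X) → Disconnected (strongDel H X)
weakDel-disconnected⇒strongDel-disconnected H X disW conS =
  disW λ u w u∈ w∈ → strongDel-path⇒weakDel-path H X (conS u w u∈ w∈)

m<n⇒m≤n∸1 : ∀ {m n} → m < n → m ≤ n ∸ 1
m<n⇒m≤n∸1 {n = suc _} (s≤s m≤n) = m≤n

p⊆q∧q─p≢∅⇒∣p∣<∣q∣ : ∀ {n} {p q : Subset n} → p ⊆ q → Nonempty (q ─ p) → ∣ p ∣ < ∣ q ∣
p⊆q∧q─p≢∅⇒∣p∣<∣q∣ {p = p} {q} p⊆q (x , x∈q─p) =
  p⊂q⇒∣p∣<∣q∣ (p⊆q , x , p─q⊆p q p x∈q─p , x∈p─q⇒x∉q q p x∈q─p)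

Disconnected⇒Nonempty : ∀ {n} (G : Hypergraph n) → Disconnected G → Nonempty (V G)
Disconnected⇒Nonempty G disconnected with nonempty? (V G)
... | yes nonempty = nonempty
... | no  empty    = contradiction (λ u _ u∈V _ → contradiction (u , u∈V) empty) disconnected

module _ {n} (del : Hypergraph n → Subset n → Hypergraph n) (H : Hypergraph n) {k : ℕ} where

  IsKappa-trivial : IsKappa del H k → ∣ V H ∣ ≤ 1 → k ≡ 1
  IsKappa-trivial (inj₁ (_ , k≡1))    _      = k≡1
  IsKappa-trivial (inj₂ (1<∣V∣ , _)) ∣V∣≤1 = contradiction ∣V∣≤1 (<⇒≱ 1<∣V∣)

  IsKappa-≤-disconnecting : IsKappa del H k → 2 ≤ ∣ V H ∣ →
    ∀ {X} → X ⊆ V H → Disconnected (del H X) → k ≤ ∣ X ∣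
  IsKappa-≤-disconnecting (inj₁ (∣V∣≤1 , _)) 1<∣V∣ _ _ = contradiction ∣V∣≤1 (<⇒≱ 1<∣V∣)
  IsKappa-≤-disconnecting (inj₂ (_ , inj₁ (_ , _ , _ , _ , minimal))) _ X⊆V disconnected =
    minimal _ X⊆V disconnected
  IsKappa-≤-disconnecting (inj₂ (_ , inj₂ (noneDisconnects , _))) _ X⊆V disconnected =
    contradiction disconnected (noneDisconnects _ X⊆V)

κS-≤-∣V∣∸1 : ∀ {n} (H : Hypergraph n) {k} → κS-is H k → 2 ≤ ∣ V H ∣ → k ≤ ∣ V H ∣ ∸ 1
κS-≤-∣V∣∸1 _ (inj₁ (∣V∣≤1 , _)) 1<∣V∣ = contradiction ∣V∣≤1 (<⇒≱ 1<∣V∣)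
κS-≤-∣V∣∸1 H (inj₂ (_ , inj₁ (Y , Y⊆V , disconnected , refl , _))) _ =
  m<n⇒m≤n∸1 (p⊆q∧q─p≢∅⇒∣p∣<∣q∣ Y⊆V (Disconnected⇒Nonempty (strongDel H Y) disconnected))
κS-≤-∣V∣∸1 _ (inj₂ (_ , inj₂ (_ , refl))) _ = ≤-refl

mainTheorem4 : ∀ (n : ℕ) (H : Hypergraph n) → WellFormed H →
    ∀ (k k′ : ℕ) → κS-is H k → κW-is H k′ → k ≤ k′
mainTheorem4 n H _ k k′ κS κW with κW
... | inj₁ (∣V∣≤1 , refl) = ≤-reflexive (IsKappa-trivial strongDel H κS ∣V∣≤1)
... | inj₂ (1<∣V∣ , inj₁ (X , X⊆V , weaklyDisconnected , refl , _)) =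
  IsKappa-≤-disconnecting strongDel H κS 1<∣V∣ X⊆V
    (weakDel-disconnected⇒strongDel-disconnected H X weaklyDisconnected)
... | inj₂ (1<∣V∣ , inj₂ (_ , refl)) = κS-≤-∣V∣∸1 H κS 1<∣V∣
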